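{- Let $G$ be a graph and let $v$ be a vertex of $G$ of degree $3$ incident with the edges $e_1,e_2,e_3$. Let $D$ be an orientation of $G$ such that either all of $e_1,e_2,e_3$ are directed away from $v$ or all of them are directed towards $v$. Let $x\in\{1,2,3,4\}$. If $G$ admits a nowhere-zero $\mathbb{Z}_6$-flow $(D,\phi)$ with $\phi(e_1)=1$, $\phi(e_2)=x$ and $\phi(e_3)=-1-x$, then $G$ admits a nowhere-zero $6$-flow $(D,\phi')$ (integer-valued, with the same orientation $D$) such that $\phi'(e_1)=1$, $\phi'(e_2)=x$ and $\phi'(e_3)=-1-x$.
   Context: Graphs are finite and may have parallel edges. For an orientation $D$ of $G$ and an abelian group $A$, an $A$-flow $(D,\phi)$ is a map $\phi:E(G)\to A$ such that at every vertex the sum of values on incoming edges equals the sum on outgoing edges; it is nowhere-zero if no edge has value $0$. A nowhere-zero $6$-flow is a $\mathbb{Z}$-flow with $0<|\phi(e)|<6$ for every edge $e$. -}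

module Defs where

open import Data.Nat using (ℕ; zero; suc; _%_; _≤_; _<_)
open import Data.Fin using (Fin; toℕ; fromℕ<)
open import Data.Fin.Properties using (_≟_)
open import Data.Integer as ℤ using (ℤ; +_; ∣_∣)
open import Data.List using (List; filter; map)
open import Data.Nat.ListAction using (sum)
open import Data.List.Base using (allFin)
open import Data.Product using (_×_; proj₁; proj₂; Σ; _,_)
open import Data.Sum using (_⊎_)
open import Relation.Binary.PropositionalEquality using (_≡_; _≢_)
open import Relation.Nullary using (¬_)
open import Data.Nat.DivMod using (_mod_)

-- A graph with n vertices and m edges (parallel edges and loops allowed),
-- together with an orientation D: edge e goes from  tail D e  to  head D e.
record Digraph (n m : ℕ) : Set where
  field
    tail : Fin m → Fin n
    head : Fin m → Fin n
open Digraph public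

inEdges : ∀ {n m} → Digraph n m → Fin n → List (Fin m)
inEdges D w = filter (λ e → head D e ≟ w) (allFin _)

outEdges : ∀ {n m} → Digraph n m → Fin n → List (Fin m)
outEdges D w = filter (λ e → tail D e ≟ w) (allFin _)

ℤ₆ : Set
ℤ₆ = Fin 6

toℤ₆ : ℕ → ℤ₆
toℤ₆ k = k mod 6

sum₆ : List ℤ₆ → ℤ₆
sum₆ xs = toℤ₆ (sum (map toℕ xs))

neg₆ : ℤ₆ → ℤ₆
neg₆ a = toℤ₆ (6 Data.Nat.∸ toℕ a)

IsZ6Flow : ∀ {n m} → Digraph n m → (Fin m → ℤ₆) → Set
IsZ6Flow D φ = ∀ w → sum₆ (map φ (inEdges D w)) ≡ sum₆ (map φ (outEdges D w))

NowhereZero₆ : ∀ {m} → (Fin m → ℤ₆) → Set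
NowhereZero₆ φ = ∀ e → toℕ (φ e) ≢ 0

sumℤ : List ℤ → ℤ
sumℤ = Data.List.foldr ℤ._+_ (+ 0)

IsZFlow : ∀ {n m} → Digraph n m → (Fin m → ℤ) → Set
IsZFlow D φ = ∀ w → sumℤ (map φ (inEdges D w)) ≡ sumℤ (map φ (outEdges D w))

Is6FlowValues : ∀ {m} → (Fin m → ℤ) → Set
Is6FlowValues φ = ∀ e → 0 < ∣ φ e ∣ × ∣ φ e ∣ < 6

Incident : ∀ {n m} → Digraph n m → Fin n → Fin m → Set
Incident D v e = (tail D e ≡ v) ⊎ (head D e ≡ v)

-- v has degree 3 and is incident exactly with the three distinct edges e₁ e₂ e₃
-- (none of which is a loop; a loop would contribute 2 to the degree)
Degree3With : ∀ {n m} → Digraph n m → Fin n → Fin m → Fin m → Fin m → Set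
Degree3With D v e₁ e₂ e₃ =
  (e₁ ≢ e₂) × (e₁ ≢ e₃) × (e₂ ≢ e₃) ×
  (Incident D v e₁ × Incident D v e₂ × Incident D v e₃) ×
  (tail D e₁ ≢ head D e₁ × tail D e₂ ≢ head D e₂ × tail D e₃ ≢ head D e₃) ×
  (∀ e → Incident D v e → (e ≡ e₁) ⊎ (e ≡ e₂) ⊎ (e ≡ e₃))

module Submission where

-- Call an integer assignment ψ admissible if 0 < |ψ e| < 6 on every edge, ψ has
-- the prescribed values on e₁, e₂, e₃, and the excess (inflow minus outflow) at
-- every vertex is a multiple of 6.  Lifting the ℤ₆-flow gives an admissible ψ.
-- If some vertex s has positive excess, let X be the set of vertices reachable
-- from s by reversing edges other than e₁, e₂, e₃, where reversing e replaces
-- ψ e by ψ e ∓ 6 and so moves 6 units of excess along e.  If X contains a vertex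
-- t of negative excess, the reversals on the way from s to t give an admissible
-- assignment with smaller total absolute excess.  Otherwise X is closed, and
-- the excess of X, at least 6, equals the flow into X, to which free edges
-- contribute at most 0 and the three frozen edges at most 1 + x ≤ 5: impossible.
-- Hence the total absolute excess can be decreased until it is zero, and the
-- resulting admissible assignment is the required 6-flow.

open import Defs
open import Data.Fin using (Fin; toℕ)
open import Data.Integer as ℤ using (ℤ; +_; -_)
open import Data.Product using (_×_; Σ)
open import Data.Sum using (_⊎_)
open import Relation.Binary.PropositionalEquality using (_≡_)

module FlowRounding where
  import Algebra.Properties.CommutativeMonoid.Sum
  open import Data.Bool using (Bool; true; false; _∨_; if_then_else_)
  open import Data.Bool.Properties using (∨-identityʳ; ∨-zeroʳ)
  import Data.Bool.Properties as Bool
  open import Data.Empty using (⊥-elim)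
  open import Data.Fin using (zero; suc; punchIn)
  open import Data.Fin.Properties using (_≟_; any?; toℕ<n; toℕ-fromℕ<)
  open import Data.Integer
    using (-[1+_]; 0ℤ; _+_; _-_; _*_; _≤_; _<_; _<?_; ∣_∣; +≤+; +<+; -≤+)
  import Data.Integer.Properties as ℤP
  open import Data.Integer.Divisibility.Signed
    using (_∣_; divides; ∣m∣n⇒∣m+n; ∣m∣n⇒∣m-n; ∣-refl)
  open import Data.Integer.Tactic.RingSolver using (solve-∀)
  open import Data.List using (List; []; _∷_; filter; map; tabulate)
  open import Data.Nat as ℕ using (ℕ; zero; suc; z≤n; s≤s; _%_; _/_)
  open import Data.Nat.DivMod using (m≡m%n+[m/n]*n; m<n⇒m%n≡m)
  open import Data.Nat.ListAction using () renaming (sum to sumᴸ)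
  import Data.Nat.Properties as ℕP
  open import Data.Product using (_,_)
  open import Data.Sum using (inj₁; inj₂; [_,_]′)
  open import Function using (_∘_)
  open import Data.Vec.Functional using (removeAt)
  open import Relation.Binary.PropositionalEquality
    using (_≢_; refl; sym; trans; cong; cong₂; subst; module ≡-Reasoning)
  open import Relation.Nullary using (Dec; yes; no; does; ¬_; contradiction)
  open import Relation.Nullary.Decidable
    using (True; dec-true; dec-false; decidable-stable; toWitness; _×-dec_; _⊎-dec_; ¬?)
  open import Relation.Unary using (Decidable)

  module ∑ℤ = Algebra.Properties.CommutativeMonoid.Sum ℤP.+-0-commutativeMonoid
  module ∑ℕ = Algebra.Properties.CommutativeMonoid.Sum ℕP.+-0-commutativeMonoid
  open ∑ℤ using (sum)

  interchange : ∀ a b c d → a + b + (c + d) ≡ a + c + (b + d)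
  interchange = solve-∀

  interchange-- : ∀ a b c d → a - b + (c - d) ≡ a + c - (b + d)
  interchange-- = solve-∀

  infixr 8 [_]·_
  [_]·_ : Bool → ℤ → ℤ
  [ true  ]· z = z
  [ false ]· z = 0ℤ

  []·-distrib-- : ∀ b y z → [ b ]· (y - z) ≡ [ b ]· y - [ b ]· z
  []·-distrib-- true  y z = refl
  []·-distrib-- false y z = refl

  []·-comm : ∀ a b z → [ a ]· [ b ]· z ≡ [ b ]· [ a ]· z
  []·-comm true  true  z = refl
  []·-comm true  false z = refl
  []·-comm false true  z = refl
  []·-comm false false z = refl

  []·-≤-self : ∀ b {z} → 0ℤ ≤ z → [ b ]· z ≤ z
  []·-≤-self true  _   = ℤP.≤-refl
  []·-≤-self false 0≤z = 0≤z

  []·-≤-0 : ∀ b {z} → z ≤ 0ℤ → [ b ]· z ≤ 0ℤ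
  []·-≤-0 true  z≤0 = z≤0
  []·-≤-0 false _   = ℤP.≤-refl

  0-≤-[]· : ∀ b {z} → 0ℤ ≤ z → 0ℤ ≤ [ b ]· z
  0-≤-[]· true  0≤z = 0≤z
  0-≤-[]· false _   = ℤP.≤-refl

  self-≤-[]· : ∀ b {z} → z ≤ 0ℤ → z ≤ [ b ]· z
  self-≤-[]· true  _   = ℤP.≤-refl
  self-≤-[]· false z≤0 = z≤0

  _==_ : ∀ {k} → Fin k → Fin k → Bool
  i == j = does (i ≟ j)

  ==-refl : ∀ {k} (i : Fin k) → (i == i) ≡ true
  ==-refl i = dec-true (i ≟ i) refl

  ==-≢ : ∀ {k} {i j : Fin k} → i ≢ j → (i == j) ≡ false
  ==-≢ {i = i} {j} = dec-false (i ≟ j)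

  ==⇒≡ : ∀ {k} {i j : Fin k} → (i == j) ≡ true → i ≡ j
  ==⇒≡ {i = i} {j} eq =
    decidable-stable (i ≟ j) (λ i≢j → contradiction (trans (sym (==-≢ i≢j)) eq) λ ())

  ∑-zero : ∀ k → sum {k} (λ _ → 0ℤ) ≡ 0ℤ
  ∑-zero = ∑ℤ.sum-replicate-zero

  ∑-distrib-- : ∀ {k} (f g : Fin k → ℤ) → sum (λ i → f i - g i) ≡ sum f - sum g
  ∑-distrib-- {zero}  f g = refl
  ∑-distrib-- {suc k} f g =
    trans (cong (_+_ (f zero - g zero)) (∑-distrib-- (f ∘ suc) (g ∘ suc)))
          (interchange-- (f zero) (g zero) _ _)

  ∑-[]· : ∀ {k} b (f : Fin k → ℤ) → [ b ]· sum f ≡ sum (λ i → [ b ]· f i)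
  ∑-[]· true  f = refl
  ∑-[]· {k} false f = sym (∑-zero k)

  ∑-δ : ∀ {k} (i : Fin k) (F : Fin k → ℤ) → sum (λ j → [ i == j ]· F j) ≡ F i
  ∑-δ {suc k} zero    F = trans (cong (_+_ (F zero)) (∑-zero k)) (ℤP.+-identityʳ (F zero))
  ∑-δ {suc k} (suc i) F = begin
    0ℤ + sum (λ j → [ suc i == suc j ]· F (suc j)) ≡⟨ ℤP.+-identityˡ _ ⟩
    sum (λ j → [ i == j ]· F (suc j))              ≡⟨ ∑-δ i (F ∘ suc) ⟩
    F (suc i)                                      ∎
    where open ≡-Reasoning

  ∑-δ-[]· : ∀ {k} (X : Fin k → Bool) (v : Fin k) z → sum (λ w → [ X w ]· [ v == w ]· z) ≡ [ X v ]· z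
  ∑-δ-[]· X v z = trans (∑ℤ.sum-cong-≗ (λ w → []·-comm (X w) (v == w) z)) (∑-δ v (λ w → [ X w ]· z))

  ∑-mono-≤ : ∀ {k} {f g : Fin k → ℤ} → (∀ i → f i ≤ g i) → sum f ≤ sum g
  ∑-mono-≤ {zero}  _   = ℤP.≤-refl
  ∑-mono-≤ {suc k} f≤g = ℤP.+-mono-≤ (f≤g zero) (∑-mono-≤ (f≤g ∘ suc))

  term≤∑ : ∀ {k} (f : Fin k → ℤ) → (∀ i → 0ℤ ≤ f i) → ∀ j → f j ≤ sum f
  term≤∑ {suc k} f f≥0 j = begin
    f j                       ≡⟨ ℤP.+-identityʳ (f j) ⟨
    f j + 0ℤ                  ≤⟨ ℤP.+-monoʳ-≤ (f j) rest≥0 ⟩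
    f j + sum (removeAt f j)  ≡⟨ ∑ℤ.sum-remove f ⟨
    sum f                     ∎
    where
    open ℤP.≤-Reasoning
    rest≥0 : 0ℤ ≤ sum (removeAt f j)
    rest≥0 = subst (_≤ sum (removeAt f j)) (∑-zero k) (∑-mono-≤ {k} (λ i → f≥0 (punchIn j i)))

  ∑≤term : ∀ {k} (f : Fin k → ℤ) → (∀ i → f i ≤ 0ℤ) → ∀ j → sum f ≤ f j
  ∑≤term {suc k} f f≤0 j = begin
    sum f                     ≡⟨ ∑ℤ.sum-remove f ⟩
    f j + sum (removeAt f j)  ≤⟨ ℤP.+-monoʳ-≤ (f j) rest≤0 ⟩
    f j + 0ℤ                  ≡⟨ ℤP.+-identityʳ (f j) ⟩
    f j                       ∎
    where
    open ℤP.≤-Reasoning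
    rest≤0 : sum (removeAt f j) ≤ 0ℤ
    rest≤0 = subst (sum (removeAt f j) ≤_) (∑-zero k) (∑-mono-≤ {k} (λ i → f≤0 (punchIn j i)))

  ∑-≤-three : ∀ {k} (f : Fin k → ℤ) {a b c : Fin k} → a ≢ b → a ≢ c → b ≢ c →
              (∀ i → i ≢ a → i ≢ b → i ≢ c → f i ≤ 0ℤ) → sum f ≤ f a + f b + f c
  ∑-≤-three f {a} {b} {c} a≢b a≢c b≢c outside≤0 = begin
    sum f            ≤⟨ ∑-mono-≤ f≤g ⟩
    sum g            ≡⟨ sum-g ⟩
    f a + f b + f c  ∎
    where
    open ℤP.≤-Reasoning
    g : _ → ℤ
    g i = [ a == i ]· f a + [ b == i ]· f b + [ c == i ]· f c

    sum-g : sum g ≡ f a + f b + f c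
    sum-g = trans (∑ℤ.∑-distrib-+ (λ i → [ a == i ]· f a + [ b == i ]· f b) (λ i → [ c == i ]· f c))
              (cong₂ _+_ (trans (∑ℤ.∑-distrib-+ (λ i → [ a == i ]· f a) (λ i → [ b == i ]· f b))
                                (cong₂ _+_ (∑-δ a (λ _ → f a)) (∑-δ b (λ _ → f b))))
                         (∑-δ c (λ _ → f c)))

    f≤g : ∀ i → f i ≤ g i
    f≤g i with a ≟ i | b ≟ i | c ≟ i
    ... | yes refl | yes refl | _        = contradiction refl a≢b
    ... | yes refl | _        | yes refl = contradiction refl a≢c
    ... | _        | yes refl | yes refl = contradiction refl b≢c
    ... | yes refl | no _     | no _     =
      ℤP.≤-reflexive (sym (trans (ℤP.+-identityʳ _) (ℤP.+-identityʳ (f a))))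
    ... | no _     | yes refl | no _     =
      ℤP.≤-reflexive (sym (trans (ℤP.+-identityʳ _) (ℤP.+-identityˡ (f b))))
    ... | no _     | no _     | yes refl = ℤP.≤-reflexive (sym (ℤP.+-identityˡ (f c)))
    ... | no i≢a   | no i≢b   | no i≢c   = outside≤0 i (i≢a ∘ sym) (i≢b ∘ sym) (i≢c ∘ sym)

  ∑ℕ-mono-≤ : ∀ {k} {f g : Fin k → ℕ} → (∀ i → f i ℕ.≤ g i) → ∑ℕ.sum f ℕ.≤ ∑ℕ.sum g
  ∑ℕ-mono-≤ {zero}  _   = z≤n
  ∑ℕ-mono-≤ {suc k} f≤g = ℕP.+-mono-≤ (f≤g zero) (∑ℕ-mono-≤ (f≤g ∘ suc))

  ∑ℕ-mono-< : ∀ {k} {f g : Fin k → ℕ} → (∀ i → f i ℕ.≤ g i) →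
              ∀ j → f j ℕ.< g j → ∑ℕ.sum f ℕ.< ∑ℕ.sum g
  ∑ℕ-mono-< f≤g zero    fj<gj = ℕP.+-mono-<-≤ fj<gj (∑ℕ-mono-≤ (f≤g ∘ suc))
  ∑ℕ-mono-< f≤g (suc j) fj<gj = ℕP.+-mono-≤-< (f≤g zero) (∑ℕ-mono-< (f≤g ∘ suc) j fj<gj)

  size : ∀ {k} → (Fin k → Bool) → ℕ
  size {zero}  X = 0
  size {suc k} X = (if X zero then 1 else 0) ℕ.+ size (X ∘ suc)

  size≤ : ∀ {k} (X : Fin k → Bool) → size X ℕ.≤ k
  size≤ {zero}  X = z≤n
  size≤ {suc k} X with X zero
  ... | true  = s≤s (size≤ (X ∘ suc))
  ... | false = ℕP.m≤n⇒m≤1+n (size≤ (X ∘ suc))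

  size-cong : ∀ {k} {X Y : Fin k → Bool} → (∀ i → X i ≡ Y i) → size X ≡ size Y
  size-cong {zero}  _   = refl
  size-cong {suc k} X≡Y = cong₂ ℕ._+_ (cong (λ b → if b then 1 else 0) (X≡Y zero)) (size-cong (X≡Y ∘ suc))

  size-insert : ∀ {k} (X : Fin k → Bool) u → X u ≡ false → size (λ i → X i ∨ (u == i)) ≡ suc (size X)
  size-insert X zero Xu≡false rewrite Xu≡false = cong suc (size-cong (λ i → ∨-identityʳ (X (suc i))))
  size-insert X (suc u) Xu≡false =
    trans (cong₂ ℕ._+_ (cong (λ b → if b then 1 else 0) (∨-identityʳ (X zero)))
                       (size-insert (X ∘ suc) u Xu≡false))
          (ℕP.+-suc _ (size (X ∘ suc)))

  sumℤ-filter : ∀ {A : Set} {p} {P : A → Set p} (P? : Decidable P) (f : A → ℤ) {k} (g : Fin k → A) →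
    sumℤ (map f (filter P? (tabulate g))) ≡ sum (λ i → [ does (P? (g i)) ]· f (g i))
  sumℤ-filter P? f {zero}  g = refl
  sumℤ-filter P? f {suc k} g with does (P? (g zero))
  ... | true  = cong (_+_ (f (g zero))) (sumℤ-filter P? f (g ∘ suc))
  ... | false = trans (sumℤ-filter P? f (g ∘ suc)) (sym (ℤP.+-identityˡ _))

  sumℤ-map-+ : ∀ {A : Set} (f g : A → ℤ) (L : List A) →
    sumℤ (map (λ a → f a + g a) L) ≡ sumℤ (map f L) + sumℤ (map g L)
  sumℤ-map-+ f g []      = refl
  sumℤ-map-+ f g (a ∷ L) = trans (cong (_+_ (f a + g a)) (sumℤ-map-+ f g L)) (interchange (f a) (g a) _ _)

  sumℤ-zero : ∀ {A : Set} (L : List A) → sumℤ (map (λ _ → 0ℤ) L) ≡ 0ℤ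
  sumℤ-zero []      = refl
  sumℤ-zero (_ ∷ L) = trans (ℤP.+-identityˡ _) (sumℤ-zero L)

  ∣-sumℤ : ∀ {A : Set} {d} (f : A → ℤ) → (∀ a → d ∣ f a) → ∀ L → d ∣ sumℤ (map f L)
  ∣-sumℤ {d = d} f d∣f []      = divides 0ℤ (sym (ℤP.*-zeroˡ d))
  ∣-sumℤ         f d∣f (a ∷ L) = ∣m∣n⇒∣m+n (d∣f a) (∣-sumℤ f d∣f L)

  bySign : {A : Set} → ℤ → A → A → A
  bySign (+ _)    a b = a
  bySign -[1+ _ ] a b = b

  bySign-map : {A B : Set} (f : A → B) (z : ℤ) (a b : A) → f (bySign z a b) ≡ bySign z (f a) (f b)
  bySign-map f (+ _)    a b = refl
  bySign-map f -[1+ _ ] a b = refl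

  -- Reversing an edge carrying z adds -6·sign z (with sign 0 = +1); on values
  -- with 0 < |z| < 6 this is the same as replacing z by z ∓ 6.
  reversal : ℤ → ℤ
  reversal (+ _)    = -[1+ 5 ]
  reversal -[1+ _ ] = + 6

  SmallNonzero : ℤ → Set
  SmallNonzero z = 0 ℕ.< ∣ z ∣ × ∣ z ∣ ℕ.< 6

  byComputation : ∀ {k} {_ : True ((0 ℕ.<? k) ×-dec (k ℕ.<? 6))} → 0 ℕ.< k × k ℕ.< 6
  byComputation {_} {ok} = toWitness ok

  reversal-small : ∀ z → SmallNonzero z → SmallNonzero (z + reversal z)
  reversal-small (+ 0)     (() , _)
  reversal-small (+ 1)     _ = byComputation
  reversal-small (+ 2)     _ = byComputation
  reversal-small (+ 3)     _ = byComputation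
  reversal-small (+ 4)     _ = byComputation
  reversal-small (+ 5)     _ = byComputation
  reversal-small (+ suc (suc (suc (suc (suc (suc _))))))
                 (_ , s≤s (s≤s (s≤s (s≤s (s≤s (s≤s ()))))))
  reversal-small -[1+ 0 ]  _ = byComputation
  reversal-small -[1+ 1 ]  _ = byComputation
  reversal-small -[1+ 2 ]  _ = byComputation
  reversal-small -[1+ 3 ]  _ = byComputation
  reversal-small -[1+ 4 ]  _ = byComputation
  reversal-small -[1+ suc (suc (suc (suc (suc _)))) ]
                 (_ , s≤s (s≤s (s≤s (s≤s (s≤s (s≤s ()))))))

  reversal-moves : ∀ z a b →
    [ a ]· reversal z - [ b ]· reversal z ≡ [ bySign z b a ]· + 6 - [ bySign z a b ]· + 6
  reversal-moves (+ _)    true  true  = refl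
  reversal-moves (+ _)    true  false = refl
  reversal-moves (+ _)    false true  = refl
  reversal-moves (+ _)    false false = refl
  reversal-moves -[1+ _ ] true  true  = refl
  reversal-moves -[1+ _ ] true  false = refl
  reversal-moves -[1+ _ ] false true  = refl
  reversal-moves -[1+ _ ] false false = refl

  -- An edge with value z contributes [ a ]· z - [ b ]· z to the flow into a
  -- set containing its head iff a and its tail iff b; this is ≤ 0 as soon as
  -- the end that reversal would push from lies in the set only together with
  -- the other end.
  inflow≤0 : ∀ z (a b : Bool) → (bySign z a b ≡ true → bySign z b a ≡ true) → [ a ]· z - [ b ]· z ≤ 0ℤ
  inflow≤0 z         true  true  _ = ℤP.≤-reflexive (ℤP.+-inverseʳ z)
  inflow≤0 z         false false _ = ℤP.≤-refl
  inflow≤0 (+ _)     true  false h = contradiction (h refl) λ ()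
  inflow≤0 -[1+ _ ]  false true  h = contradiction (h refl) λ ()
  inflow≤0 (+ 0)     false true  _ = ℤP.≤-refl
  inflow≤0 (+ suc _) false true  _ = -≤+
  inflow≤0 -[1+ k ]  true  false _ = ℤP.≤-trans (ℤP.≤-reflexive (ℤP.+-identityʳ -[1+ k ])) -≤+

  -- Three edges at a common vertex carrying z₁, z₂ and -(z₁ + z₂): their flow
  -- into a vertex set is the sum of the values on the edges whose far end lies
  -- in the set (sign reversed for edges pointing towards the vertex); the
  -- membership of the common vertex (a) cancels out.
  three-outgoing : ∀ a b₁ b₂ b₃ z₁ z₂ →
    ([ b₁ ]· z₁ - [ a ]· z₁) + ([ b₂ ]· z₂ - [ a ]· z₂) + ([ b₃ ]· - (z₁ + z₂) - [ a ]· - (z₁ + z₂))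
      ≡ [ b₁ ]· z₁ + [ b₂ ]· z₂ + [ b₃ ]· - (z₁ + z₂)
  three-outgoing true  b₁ b₂ b₃ z₁ z₂ = regroup ([ b₁ ]· z₁) ([ b₂ ]· z₂) ([ b₃ ]· - (z₁ + z₂)) z₁ z₂
    where regroup : ∀ p q r z₁ z₂ → p - z₁ + (q - z₂) + (r - - (z₁ + z₂)) ≡ p + q + r
          regroup = solve-∀
  three-outgoing false b₁ b₂ b₃ z₁ z₂ = regroup ([ b₁ ]· z₁) ([ b₂ ]· z₂) ([ b₃ ]· - (z₁ + z₂))
    where regroup : ∀ p q r → p - 0ℤ + (q - 0ℤ) + (r - 0ℤ) ≡ p + q + r
          regroup = solve-∀

  three-incoming : ∀ a b₁ b₂ b₃ z₁ z₂ →
    ([ a ]· z₁ - [ b₁ ]· z₁) + ([ a ]· z₂ - [ b₂ ]· z₂) + ([ a ]· - (z₁ + z₂) - [ b₃ ]· - (z₁ + z₂))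
      ≡ - ([ b₁ ]· z₁ + [ b₂ ]· z₂ + [ b₃ ]· - (z₁ + z₂))
  three-incoming true  b₁ b₂ b₃ z₁ z₂ = regroup ([ b₁ ]· z₁) ([ b₂ ]· z₂) ([ b₃ ]· - (z₁ + z₂)) z₁ z₂
    where regroup : ∀ p q r z₁ z₂ → z₁ - p + (z₂ - q) + (- (z₁ + z₂) - r) ≡ - (p + q + r)
          regroup = solve-∀
  three-incoming false b₁ b₂ b₃ z₁ z₂ = regroup ([ b₁ ]· z₁) ([ b₂ ]· z₂) ([ b₃ ]· - (z₁ + z₂))
    where regroup : ∀ p q r → 0ℤ - p + (0ℤ - q) + (0ℤ - r) ≡ - (p + q + r)
          regroup = solve-∀

  sub-sum≤ : ∀ b₁ b₂ b₃ p q → [ b₁ ]· + p + [ b₂ ]· + q + [ b₃ ]· - (+ p + + q) ≤ + p + + q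
  sub-sum≤ b₁ b₂ b₃ p q = begin
    [ b₁ ]· + p + [ b₂ ]· + q + [ b₃ ]· - (+ p + + q)
      ≤⟨ ℤP.+-mono-≤ (ℤP.+-mono-≤ ([]·-≤-self b₁ (+≤+ z≤n)) ([]·-≤-self b₂ (+≤+ z≤n)))
                     ([]·-≤-0 b₃ (ℤP.neg-mono-≤ (+≤+ z≤n))) ⟩
    + p + + q + 0ℤ
      ≡⟨ ℤP.+-identityʳ _ ⟩
    + p + + q ∎
    where open ℤP.≤-Reasoning

  sub-sum≥ : ∀ b₁ b₂ b₃ p q → - (+ p + + q) ≤ [ b₁ ]· + p + [ b₂ ]· + q + [ b₃ ]· - (+ p + + q)
  sub-sum≥ b₁ b₂ b₃ p q = begin
    - (+ p + + q)
      ≡⟨ ℤP.+-identityˡ _ ⟨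
    0ℤ + 0ℤ + - (+ p + + q)
      ≤⟨ ℤP.+-mono-≤ (ℤP.+-mono-≤ (0-≤-[]· b₁ (+≤+ z≤n)) (0-≤-[]· b₂ (+≤+ z≤n)))
                     (self-≤-[]· b₃ (ℤP.neg-mono-≤ (+≤+ z≤n))) ⟩
    [ b₁ ]· + p + [ b₂ ]· + q + [ b₃ ]· - (+ p + + q) ∎
    where open ℤP.≤-Reasoning

  positive-multiple : ∀ {z} → + 6 ∣ z → 0ℤ < z → Σ ℕ λ k → z ≡ + (6 ℕ.+ k)
  positive-multiple (divides (+ zero)  refl) (+<+ ())
  positive-multiple (divides (+ suc q) refl) _ = q ℕ.* 6 , refl
  positive-multiple (divides -[1+ q ]  refl) ()

  negative-multiple : ∀ {z} → + 6 ∣ z → z < 0ℤ → Σ ℕ λ k → z ≡ -[1+ 5 ℕ.+ k ]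
  negative-multiple (divides (+ zero)  refl) (+<+ ())
  negative-multiple (divides (+ suc q) refl) (+<+ ())
  negative-multiple (divides -[1+ q ]  refl) _ = q ℕ.* 6 , refl

  toward-0-from-above : ∀ {z} → + 6 ∣ z → 0ℤ < z → ∣ z - + 6 ∣ ℕ.< ∣ z ∣
  toward-0-from-above 6∣z 0<z with positive-multiple 6∣z 0<z
  ... | k , refl = s≤s (ℕP.m≤n+m k 5)

  toward-0-from-below : ∀ {z} → + 6 ∣ z → z < 0ℤ → ∣ z + + 6 ∣ ℕ.≤ ∣ z ∣
  toward-0-from-below 6∣z z<0 with negative-multiple 6∣z z<0
  ... | k , refl = subst (ℕ._≤ 6 ℕ.+ k) (sym (trans (cong ∣_∣ (cancel (+ k))) (ℤP.∣-i∣≡∣i∣ (+ k))))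
                         (ℕP.m≤n+m k 6)
    where cancel : ∀ a → - (+ 6 + a) + + 6 ≡ - a
          cancel = solve-∀

  module Network {n m : ℕ} (D : Digraph n m) where

    excess : (Fin m → ℤ) → Fin n → ℤ
    excess ψ w = sumℤ (map ψ (inEdges D w)) - sumℤ (map ψ (outEdges D w))

    balanced⇒flow : ∀ ψ → (∀ w → excess ψ w ≡ 0ℤ) → IsZFlow D ψ
    balanced⇒flow ψ balanced w = ℤP.i-j≡0⇒i≡j _ _ (balanced w)

    excess-+ : ∀ f g w → excess (λ e → f e + g e) w ≡ excess f w + excess g w
    excess-+ f g w =
      trans (cong₂ _-_ (sumℤ-map-+ f g (inEdges D w)) (sumℤ-map-+ f g (outEdges D w)))
            (sym (interchange-- (sumℤ (map f (inEdges D w))) (sumℤ (map f (outEdges D w)))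
                                (sumℤ (map g (inEdges D w))) (sumℤ (map g (outEdges D w)))))

    excess-zero : ∀ w → excess (λ _ → 0ℤ) w ≡ 0ℤ
    excess-zero w = cong₂ _-_ (sumℤ-zero (inEdges D w)) (sumℤ-zero (outEdges D w))

    excess-∣ : ∀ {d} ψ → (∀ e → d ∣ ψ e) → ∀ w → d ∣ excess ψ w
    excess-∣ ψ d∣ψ w = ∣m∣n⇒∣m-n (∣-sumℤ ψ d∣ψ (inEdges D w)) (∣-sumℤ ψ d∣ψ (outEdges D w))

    excess-∑ : ∀ ψ w → excess ψ w ≡ sum (λ e → [ head D e == w ]· ψ e - [ tail D e == w ]· ψ e)
    excess-∑ ψ w =
      trans (cong₂ _-_ (sumℤ-filter (λ e → head D e ≟ w) ψ (λ e → e))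
                       (sumℤ-filter (λ e → tail D e ≟ w) ψ (λ e → e)))
            (sym (∑-distrib-- {m} _ _))

    excess-edge : ∀ e d w → excess (λ e′ → [ e == e′ ]· d) w ≡ [ head D e == w ]· d - [ tail D e == w ]· d
    excess-edge e d w =
      trans (excess-∑ _ w)
            (trans (∑-distrib-- {m} _ _)
                   (cong₂ _-_ (∑-δ-[]· (λ e′ → head D e′ == w) e d) (∑-δ-[]· (λ e′ → tail D e′ == w) e d)))

    inflow : (Fin n → Bool) → (Fin m → ℤ) → Fin m → ℤ
    inflow X ψ e = [ X (head D e) ]· ψ e - [ X (tail D e) ]· ψ e

    cut : ∀ X ψ → sum (λ w → [ X w ]· excess ψ w) ≡ sum (inflow X ψ)
    cut X ψ = begin
      sum (λ w → [ X w ]· excess ψ w)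
        ≡⟨ ∑ℤ.sum-cong-≗ (λ w → trans (cong [ X w ]·_ (excess-∑ ψ w)) (∑-[]· {m} (X w) _)) ⟩
      sum (λ w → sum (λ e → [ X w ]· ([ head D e == w ]· ψ e - [ tail D e == w ]· ψ e)))
        ≡⟨ ∑ℤ.∑-comm {n} {m} _ ⟩
      sum (λ e → sum (λ w → [ X w ]· ([ head D e == w ]· ψ e - [ tail D e == w ]· ψ e)))
        ≡⟨ ∑ℤ.sum-cong-≗ {m} (λ e → trans (∑ℤ.sum-cong-≗ {n} (λ w → []·-distrib-- (X w) _ _)) (∑-distrib-- {n} _ _)) ⟩
      sum (λ e → sum (λ w → [ X w ]· [ head D e == w ]· ψ e) - sum (λ w → [ X w ]· [ tail D e == w ]· ψ e))
        ≡⟨ ∑ℤ.sum-cong-≗ (λ e → cong₂ _-_ (∑-δ-[]· X (head D e) (ψ e)) (∑-δ-[]· X (tail D e) (ψ e))) ⟩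
      sum (inflow X ψ)
        ∎
      where open ≡-Reasoning

    ∑-excess : ∀ ψ → sum (excess ψ) ≡ 0ℤ
    ∑-excess ψ = trans (cut (λ _ → true) ψ)
                       (trans (∑ℤ.sum-cong-≗ {m} (λ e → ℤP.+-inverseʳ (ψ e))) (∑-zero m))

    excess≤0⇒≡0 : ∀ ψ → (∀ w → excess ψ w ≤ 0ℤ) → ∀ w → excess ψ w ≡ 0ℤ
    excess≤0⇒≡0 ψ ≤0 w =
      ℤP.≤-antisym (≤0 w) (subst (_≤ excess ψ w) (∑-excess ψ) (∑≤term (excess ψ) ≤0 w))

    -- Reversing e moves 6 units of excess from  pushFrom ψ e  to  pushTo ψ e.
    pushFrom pushTo : (Fin m → ℤ) → Fin m → Fin n
    pushFrom ψ e = bySign (ψ e) (head D e) (tail D e)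
    pushTo   ψ e = bySign (ψ e) (tail D e) (head D e)

    excess-reversal : ∀ ψ e w →
      excess (λ e′ → [ e == e′ ]· reversal (ψ e)) w ≡ [ pushTo ψ e == w ]· + 6 - [ pushFrom ψ e == w ]· + 6
    excess-reversal ψ e w =
      trans (excess-edge e (reversal (ψ e)) w)
            (trans (reversal-moves (ψ e) (head D e == w) (tail D e == w))
                   (sym (cong₂ (λ p q → [ p ]· + 6 - [ q ]· + 6)
                               (bySign-map (_== w) (ψ e) (tail D e) (head D e))
                               (bySign-map (_== w) (ψ e) (head D e) (tail D e)))))

    ends-of-push : ∀ (X : Fin n → Bool) ψ e → X (pushFrom ψ e) ≡ true → X (pushTo ψ e) ≡ true →
                   X (head D e) ≡ true × X (tail D e) ≡ true
    ends-of-push X ψ e from∈X to∈X with ψ e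
    ... | + _      = from∈X , to∈X
    ... | -[1+ _ ] = to∈X , from∈X

    push-of-ends : ∀ (X : Fin n → Bool) ψ e → X (head D e) ≡ true → X (tail D e) ≡ true → X (pushTo ψ e) ≡ true
    push-of-ends X ψ e head∈X tail∈X with ψ e
    ... | + _      = tail∈X
    ... | -[1+ _ ] = head∈X

    Closed : (Fin m → Set) → (Fin m → ℤ) → (Fin n → Bool) → Set
    Closed Frozen ψ X = ∀ e → ¬ Frozen e → X (pushFrom ψ e) ≡ true → X (pushTo ψ e) ≡ true

    closed-inflow≤0 : ∀ {Frozen} ψ X → Closed Frozen ψ X → ∀ e → ¬ Frozen e → inflow X ψ e ≤ 0ℤ
    closed-inflow≤0 ψ X closed e free =
      inflow≤0 (ψ e) (X (head D e)) (X (tail D e))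
        (λ p → trans (sym (bySign-map X (ψ e) (tail D e) (head D e)))
                     (closed e free (trans (bySign-map X (ψ e) (head D e) (tail D e)) p)))

    -- Vertex sets reachable from s by reversals of non-frozen edges, each
    -- member w carrying an explicit transfer of 6 units of excess from s to w.
    module Reach (Frozen : Fin m → Set) (frozen? : Decidable Frozen) (ψ : Fin m → ℤ) (s : Fin n) where

      ReversalInside : (Fin n → Bool) → (Fin m → ℤ) → Fin m → Set
      ReversalInside X δ e =
        δ e ≡ 0ℤ ⊎ (δ e ≡ reversal (ψ e) × ¬ Frozen e × X (head D e) ≡ true × X (tail D e) ≡ true)

      record Transfer (X : Fin n → Bool) (w : Fin n) : Set where
        field
          change : Fin m → ℤ
          moves  : ∀ u → excess change u ≡ [ w == u ]· + 6 - [ s == u ]· + 6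
          inside : ∀ e → ReversalInside X change e

      transfer-mono : ∀ {X Y w} → (∀ u → X u ≡ true → Y u ≡ true) → Transfer X w → Transfer Y w
      transfer-mono {X} {Y} X⊆Y T = record { change = change ; moves = moves ; inside = inside′ }
        where
        open Transfer T
        inside′ : ∀ e → ReversalInside Y change e
        inside′ e with inside e
        ... | inj₁ unchanged                      = inj₁ unchanged
        ... | inj₂ (rev , free , head∈X , tail∈X) = inj₂ (rev , free , X⊆Y _ head∈X , X⊆Y _ tail∈X)

      record ReachableSet : Set where
        field
          members  : Fin n → Bool
          has-s    : members s ≡ true
          transfer : ∀ w → members w ≡ true → Transfer members w
      open ReachableSet

      singleton : ReachableSet
      singleton = record
        { members  = s ==_
        ; has-s    = ==-refl s
        ; transfer = λ w s==w → subst (Transfer (s ==_)) (==⇒≡ s==w) stay }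
        where
        stay : Transfer (s ==_) s
        stay = record
          { change = λ _ → 0ℤ
          ; moves  = λ u → trans (excess-zero u) (sym (ℤP.+-inverseʳ ([ s == u ]· + 6)))
          ; inside = λ _ → inj₁ refl }

      ExitEdge : ReachableSet → Fin m → Set
      ExitEdge R e = ¬ Frozen e × members R (pushFrom ψ e) ≡ true × members R (pushTo ψ e) ≡ false

      exitEdge? : ∀ R e → Dec (ExitEdge R e)
      exitEdge? R e = ¬? (frozen? e) ×-dec (members R (pushFrom ψ e) Bool.≟ true)
                                     ×-dec (members R (pushTo ψ e) Bool.≟ false)

      extend : (R : ReachableSet) (e : Fin m) → ExitEdge R e → ReachableSet
      extend R e (free , from∈R , to∉R) = record
        { members = X′ ; has-s = grow s (has-s R) ; transfer = transfer′ }
        where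
        u : Fin n
        u = pushTo ψ e

        X′ : Fin n → Bool
        X′ y = members R y ∨ (u == y)

        grow : ∀ y → members R y ≡ true → X′ y ≡ true
        grow y y∈R rewrite y∈R = refl

        u∈X′ : X′ u ≡ true
        u∈X′ = trans (cong (members R u ∨_) (==-refl u)) (∨-zeroʳ (members R u))

        T : Transfer (members R) (pushFrom ψ e)
        T = transfer R (pushFrom ψ e) from∈R
        open Transfer T

        δ′ : Fin m → ℤ
        δ′ e′ = change e′ + [ e == e′ ]· reversal (ψ e)

        moves′ : ∀ y → excess δ′ y ≡ [ u == y ]· + 6 - [ s == y ]· + 6
        moves′ y = trans (excess-+ change (λ e′ → [ e == e′ ]· reversal (ψ e)) y)
                         (trans (cong₂ _+_ (moves y) (excess-reversal ψ e y))
                                (telescope ([ pushFrom ψ e == y ]· + 6) ([ s == y ]· + 6) ([ u == y ]· + 6)))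
          where telescope : ∀ a b c → a - b + (c - a) ≡ c - b
                telescope = solve-∀

        -- T does not reverse e, since the far end of e lies outside R.
        e-unchanged : change e ≡ 0ℤ
        e-unchanged with inside e
        ... | inj₁ unchanged            = unchanged
        ... | inj₂ (_ , _ , h∈R , t∈R) = contradiction (trans (sym (push-of-ends (members R) ψ e h∈R t∈R)) to∉R) λ ()

        inside′ : ∀ e′ → (change e′ + [ e == e′ ]· reversal (ψ e) ≡ 0ℤ) ⊎
                         (change e′ + [ e == e′ ]· reversal (ψ e) ≡ reversal (ψ e′) × ¬ Frozen e′ ×
                          X′ (head D e′) ≡ true × X′ (tail D e′) ≡ true)
        inside′ e′ with e ≟ e′
        ... | yes refl = inj₂ (trans (cong (_+ reversal (ψ e)) e-unchanged) (ℤP.+-identityˡ _) ,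
                               free , ends-of-push X′ ψ e (grow _ from∈R) u∈X′)
        ... | no _ with inside e′
        ...   | inj₁ unchanged = inj₁ (trans (ℤP.+-identityʳ _) unchanged)
        ...   | inj₂ (rev , free′ , h∈R , t∈R) =
                  inj₂ (trans (ℤP.+-identityʳ _) rev , free′ , grow _ h∈R , grow _ t∈R)

        arrive : Transfer X′ u
        arrive = record { change = δ′ ; moves = moves′ ; inside = inside′ }

        transfer′ : ∀ y → X′ y ≡ true → Transfer X′ y
        transfer′ y y∈X′ with members R y in y∈R
        ... | true  = transfer-mono grow (transfer R y y∈R)
        ... | false = subst (Transfer X′) (==⇒≡ y∈X′) arrive

      extend-size : ∀ R e (exit : ExitEdge R e) → size (members (extend R e exit)) ≡ suc (size (members R))
      extend-size R e (_ , _ , to∉R) = size-insert (members R) (pushTo ψ e) to∉R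

      -- Extending while an exit edge exists terminates after at most n steps
      -- in a closed reachable set.
      close : (fuel : ℕ) (R : ReachableSet) → n ℕ.≤ size (members R) ℕ.+ fuel →
              Σ ReachableSet (λ R → Closed Frozen ψ (members R))
      close fuel R bound with any? (exitEdge? R)
      ... | no noExit = R , closed
        where
        closed : Closed Frozen ψ (members R)
        closed e free from∈R with members R (pushTo ψ e) in to∈R
        ... | true  = refl
        ... | false = contradiction (e , free , from∈R , to∈R) noExit
      close zero R bound | yes (e , exit) =
        ⊥-elim (ℕP.<-irrefl refl
                 (ℕP.≤-trans (subst (ℕ._≤ n) (extend-size R e exit) (size≤ (members (extend R e exit))))
                             (subst (n ℕ.≤_) (ℕP.+-identityʳ _) bound)))
      close (suc fuel) R bound | yes (e , exit) =
        close fuel (extend R e exit)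
              (subst (n ℕ.≤_) (trans (ℕP.+-suc _ fuel) (cong (ℕ._+ fuel) (sym (extend-size R e exit)))) bound)

      closure : Σ ReachableSet (λ R → Closed Frozen ψ (members R))
      closure = close n singleton (ℕP.m≤n+m n _)

  toℕ-toℤ₆ : ∀ k → k ℕ.< 6 → toℕ (toℤ₆ k) ≡ k
  toℕ-toℤ₆ k k<6 = trans (toℕ-fromℕ< _) (m<n⇒m%n≡m k<6)

  equal-residues⇒6∣ : ∀ a b → toℤ₆ a ≡ toℤ₆ b → + 6 ∣ + a - + b
  equal-residues⇒6∣ a b eq = divides (+ (a / 6) - + (b / 6)) (begin
    + a - + b
      ≡⟨ cong₂ _-_ (split a) (split b) ⟩
    + (a % 6) + + (a / 6) * + 6 - (+ (b % 6) + + (b / 6) * + 6)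
      ≡⟨ cong (λ r → + r + + (a / 6) * + 6 - (+ (b % 6) + + (b / 6) * + 6)) same-residue ⟩
    + (b % 6) + + (a / 6) * + 6 - (+ (b % 6) + + (b / 6) * + 6)
      ≡⟨ cancel (+ (b % 6)) (+ (a / 6)) (+ (b / 6)) ⟩
    (+ (a / 6) - + (b / 6)) * + 6 ∎)
    where
    open ≡-Reasoning
    same-residue : a % 6 ≡ b % 6
    same-residue = trans (sym (toℕ-fromℕ< _)) (trans (cong toℕ eq) (toℕ-fromℕ< _))
    split : ∀ c → + c ≡ + (c % 6) + + (c / 6) * + 6
    split c = trans (cong +_ (m≡m%n+[m/n]*n c 6)) (cong (_+_ (+ (c % 6))) (ℤP.pos-* (c / 6) 6))
    cancel : ∀ r p q → r + p * + 6 - (r + q * + 6) ≡ (p - q) * + 6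
    cancel = solve-∀

  sumℤ-representatives : ∀ {k} (φ : Fin k → ℤ₆) (L : List (Fin k)) →
    sumℤ (map (λ e → + toℕ (φ e)) L) ≡ + sumᴸ (map toℕ (map φ L))
  sumℤ-representatives φ []      = refl
  sumℤ-representatives φ (e ∷ L) = cong (_+_ (+ toℕ (φ e))) (sumℤ-representatives φ L)

  lowered-representative : ∀ x → x ℕ.≤ 4 → + toℕ (neg₆ (toℤ₆ (1 ℕ.+ x))) + -[1+ 5 ] ≡ - (+ (1 ℕ.+ x))
  lowered-representative 0 _ = refl
  lowered-representative 1 _ = refl
  lowered-representative 2 _ = refl
  lowered-representative 3 _ = refl
  lowered-representative 4 _ = refl
  lowered-representative (suc (suc (suc (suc (suc _))))) (s≤s (s≤s (s≤s (s≤s ()))))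

  module Rounding {n m : ℕ} (D : Digraph n m) (v : Fin n) (e₁ e₂ e₃ : Fin m)
      (e₁≢e₂ : e₁ ≢ e₂) (e₁≢e₃ : e₁ ≢ e₃) (e₂≢e₃ : e₂ ≢ e₃)
      (oriented : (tail D e₁ ≡ v × tail D e₂ ≡ v × tail D e₃ ≡ v) ⊎
                  (head D e₁ ≡ v × head D e₂ ≡ v × head D e₃ ≡ v))
      (x : ℕ) (x≤4 : x ℕ.≤ 4) where
    open Network D

    Frozen : Fin m → Set
    Frozen e = e ≡ e₁ ⊎ e ≡ e₂ ⊎ e ≡ e₃

    frozen? : Decidable Frozen
    frozen? e = (e ≟ e₁) ⊎-dec (e ≟ e₂) ⊎-dec (e ≟ e₃)

    record Admissible (ψ : Fin m → ℤ) : Set where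
      field
        small         : Is6FlowValues ψ
        excess-mod-6  : ∀ w → + 6 ∣ excess ψ w
        at-e₁         : ψ e₁ ≡ + 1
        at-e₂         : ψ e₂ ≡ + x
        at-e₃         : ψ e₃ ≡ - (+ (1 ℕ.+ x))
    open Admissible

    imbalance : (Fin m → ℤ) → ℕ
    imbalance ψ = ∑ℕ.sum (λ w → ∣ excess ψ w ∣)

    frozen-inflow≤ : ∀ ψ → Admissible ψ → ∀ X →
                     inflow X ψ e₁ + inflow X ψ e₂ + inflow X ψ e₃ ≤ + 1 + + x
    frozen-inflow≤ ψ adm X = [ outgoing , incoming ]′ oriented
      where
      goal : Set
      goal = inflow X ψ e₁ + inflow X ψ e₂ + inflow X ψ e₃ ≤ + 1 + + x

      inflow-leaving : ∀ e {z} → tail D e ≡ v → ψ e ≡ z → inflow X ψ e ≡ [ X (head D e) ]· z - [ X v ]· z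
      inflow-leaving e = cong₂ (λ a z → [ X (head D e) ]· z - [ X a ]· z)

      inflow-entering : ∀ e {z} → head D e ≡ v → ψ e ≡ z → inflow X ψ e ≡ [ X v ]· z - [ X (tail D e) ]· z
      inflow-entering e = cong₂ (λ a z → [ X a ]· z - [ X (tail D e) ]· z)

      outgoing : tail D e₁ ≡ v × tail D e₂ ≡ v × tail D e₃ ≡ v → goal
      outgoing (t₁ , t₂ , t₃) =
        ℤP.≤-trans (ℤP.≤-reflexive (trans (cong₂ _+_ (cong₂ _+_ (inflow-leaving e₁ t₁ (at-e₁ adm))
                                                                (inflow-leaving e₂ t₂ (at-e₂ adm)))
                                                     (inflow-leaving e₃ t₃ (at-e₃ adm)))
                                          (three-outgoing (X v) (X (head D e₁)) (X (head D e₂)) (X (head D e₃)) (+ 1) (+ x))))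
                   (sub-sum≤ (X (head D e₁)) (X (head D e₂)) (X (head D e₃)) 1 x)

      incoming : head D e₁ ≡ v × head D e₂ ≡ v × head D e₃ ≡ v → goal
      incoming (h₁ , h₂ , h₃) =
        ℤP.≤-trans (ℤP.≤-reflexive (trans (cong₂ _+_ (cong₂ _+_ (inflow-entering e₁ h₁ (at-e₁ adm))
                                                                (inflow-entering e₂ h₂ (at-e₂ adm)))
                                                     (inflow-entering e₃ h₃ (at-e₃ adm)))
                                          (three-incoming (X v) (X (tail D e₁)) (X (tail D e₂)) (X (tail D e₃)) (+ 1) (+ x))))
                   (subst (- ([ X (tail D e₁) ]· + 1 + [ X (tail D e₂) ]· + x + [ X (tail D e₃) ]· - (+ 1 + + x)) ≤_)
                          (ℤP.neg-involutive (+ 1 + + x))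
                          (ℤP.neg-mono-≤ (sub-sum≥ (X (tail D e₁)) (X (tail D e₂)) (X (tail D e₃)) 1 x)))

    closed-excess≤5 : ∀ ψ → Admissible ψ → ∀ X → Closed Frozen ψ X →
                      sum (λ w → [ X w ]· excess ψ w) ≤ + 5
    closed-excess≤5 ψ adm X closed = begin
      sum (λ w → [ X w ]· excess ψ w)                ≡⟨ cut X ψ ⟩
      sum (inflow X ψ)                               ≤⟨ ∑-≤-three (inflow X ψ) e₁≢e₂ e₁≢e₃ e₂≢e₃ free≤0 ⟩
      inflow X ψ e₁ + inflow X ψ e₂ + inflow X ψ e₃   ≤⟨ frozen-inflow≤ ψ adm X ⟩
      + (1 ℕ.+ x)                                    ≤⟨ +≤+ (s≤s x≤4) ⟩
      + 5                                            ∎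
      where
      open ℤP.≤-Reasoning
      free≤0 : ∀ e → e ≢ e₁ → e ≢ e₂ → e ≢ e₃ → inflow X ψ e ≤ 0ℤ
      free≤0 e e≢e₁ e≢e₂ e≢e₃ =
        closed-inflow≤0 ψ X closed e [ e≢e₁ , [ e≢e₂ , e≢e₃ ]′ ]′

    closed-set-has-deficit : ∀ ψ → Admissible ψ → ∀ X s → Closed Frozen ψ X → X s ≡ true →
                             0ℤ < excess ψ s → ¬ (∀ w → X w ≡ true → 0ℤ ≤ excess ψ w)
    closed-set-has-deficit ψ adm X s closed s∈X 0<excess no-deficit =
      ℤP.<-irrefl refl (ℤP.≤-<-trans six≤five (+<+ ℕP.≤-refl))
      where
      contribution≥0 : ∀ w → 0ℤ ≤ [ X w ]· excess ψ w
      contribution≥0 w with X w in w∈X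
      ... | true  = no-deficit w w∈X
      ... | false = ℤP.≤-refl

      six≤excess : + 6 ≤ excess ψ s
      six≤excess with positive-multiple (excess-mod-6 adm s) 0<excess
      ... | k , eq rewrite eq = +≤+ (ℕP.m≤m+n 6 k)

      six≤five : + 6 ≤ + 5
      six≤five = begin
        + 6                                 ≤⟨ six≤excess ⟩
        excess ψ s                          ≡⟨ cong (λ b → [ b ]· excess ψ s) s∈X ⟨
        [ X s ]· excess ψ s                 ≤⟨ term≤∑ _ contribution≥0 s ⟩
        sum (λ w → [ X w ]· excess ψ w)     ≤⟨ closed-excess≤5 ψ adm X closed ⟩
        + 5                                 ∎
        where open ℤP.≤-Reasoning

    transfer-step : ∀ ψ → Admissible ψ → ∀ s X t → Reach.Transfer Frozen frozen? ψ s X t →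
                    0ℤ < excess ψ s → excess ψ t < 0ℤ →
                    Σ (Fin m → ℤ) λ ψ′ → Admissible ψ′ × imbalance ψ′ ℕ.< imbalance ψ
    transfer-step ψ adm s X t T 0<s t<0 = ψ′ , adm′ , ∑ℕ-mono-< pointwise s at-s
      where
      open Reach.Transfer T

      ψ′ : Fin m → ℤ
      ψ′ e = ψ e + change e

      small′ : Is6FlowValues ψ′
      small′ e with inside e
      ... | inj₁ unchanged = subst SmallNonzero (sym (trans (cong (_+_ (ψ e)) unchanged) (ℤP.+-identityʳ (ψ e))))
                                   (small adm e)
      ... | inj₂ (rev , _) = subst SmallNonzero (cong (_+_ (ψ e)) (sym rev)) (reversal-small (ψ e) (small adm e))

      keeps : ∀ e → Frozen e → ψ′ e ≡ ψ e
      keeps e frozen with inside e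
      ... | inj₁ unchanged     = trans (cong (_+_ (ψ e)) unchanged) (ℤP.+-identityʳ (ψ e))
      ... | inj₂ (_ , free , _) = contradiction frozen free

      shift : ∀ y → excess ψ′ y ≡ excess ψ y + ([ t == y ]· + 6 - [ s == y ]· + 6)
      shift y = trans (excess-+ ψ change y) (cong (_+_ (excess ψ y)) (moves y))

      6∣[]· : ∀ b → + 6 ∣ [ b ]· + 6
      6∣[]· true  = ∣-refl
      6∣[]· false = divides 0ℤ refl

      adm′ : Admissible ψ′
      adm′ = record
        { small        = small′
        ; excess-mod-6 = λ y → subst (+ 6 ∣_) (sym (shift y))
                                     (∣m∣n⇒∣m+n (excess-mod-6 adm y) (∣m∣n⇒∣m-n (6∣[]· (t == y)) (6∣[]· (s == y))))
        ; at-e₁        = trans (keeps e₁ (inj₁ refl)) (at-e₁ adm)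
        ; at-e₂        = trans (keeps e₂ (inj₂ (inj₁ refl))) (at-e₂ adm)
        ; at-e₃        = trans (keeps e₃ (inj₂ (inj₂ refl))) (at-e₃ adm) }

      s≢t : s ≢ t
      s≢t refl = ℤP.<-asym 0<s t<0

      pointwise : ∀ y → ∣ excess ψ′ y ∣ ℕ.≤ ∣ excess ψ y ∣
      pointwise y rewrite shift y with t == y in t=y | s == y in s=y
      ... | true  | true  = contradiction (trans (==⇒≡ s=y) (sym (==⇒≡ t=y))) s≢t
      ... | true  | false = subst (λ z → ∣ excess ψ z + + 6 ∣ ℕ.≤ ∣ excess ψ z ∣) (==⇒≡ t=y)
                                  (toward-0-from-below (excess-mod-6 adm t) t<0)
      ... | false | true  = subst (λ z → ∣ excess ψ z - + 6 ∣ ℕ.≤ ∣ excess ψ z ∣) (==⇒≡ s=y)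
                                  (ℕP.<⇒≤ (toward-0-from-above (excess-mod-6 adm s) 0<s))
      ... | false | false = ℕP.≤-reflexive (cong ∣_∣ (ℤP.+-identityʳ (excess ψ y)))

      at-s : ∣ excess ψ′ s ∣ ℕ.< ∣ excess ψ s ∣
      at-s rewrite shift s | ==-≢ (s≢t ∘ sym) | ==-refl s = toward-0-from-above (excess-mod-6 adm s) 0<s

    open Reach.ReachableSet using (members; has-s; transfer)

    improve : ∀ ψ → Admissible ψ → ∀ s → 0ℤ < excess ψ s →
              Σ (Fin m → ℤ) λ ψ′ → Admissible ψ′ × imbalance ψ′ ℕ.< imbalance ψ
    improve ψ adm s 0<s with Reach.closure Frozen frozen? ψ s
    ... | R , closed with any? (λ w → (members R w Bool.≟ true) ×-dec (excess ψ w <? 0ℤ))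
    ...   | yes (t , t∈R , t<0) = transfer-step ψ adm s (members R) t (transfer R t t∈R) 0<s t<0
    ...   | no noDeficit =
      contradiction (λ w w∈R → ℤP.≮⇒≥ (λ w<0 → noDeficit (w , w∈R , w<0)))
                    (closed-set-has-deficit ψ adm (members R) s closed (has-s R) 0<s)

    descend : (fuel : ℕ) → ∀ ψ → Admissible ψ → imbalance ψ ℕ.< fuel →
              Σ (Fin m → ℤ) λ ψ′ → Admissible ψ′ × (∀ w → excess ψ′ w ≡ 0ℤ)
    descend zero       ψ adm ()
    descend (suc fuel) ψ adm bound with any? (λ w → 0ℤ <? excess ψ w)
    ... | no noSurplus = ψ , adm , excess≤0⇒≡0 ψ (λ w → ℤP.≮⇒≥ (λ 0<w → noSurplus (w , 0<w)))
    ... | yes (s , 0<s) with improve ψ adm s 0<s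
    ...   | ψ′ , adm′ , smaller = descend fuel ψ′ adm′ (ℕP.≤-trans smaller (ℕP.≤-pred bound))

    lift : (φ : Fin m → ℤ₆) → IsZ6Flow D φ → NowhereZero₆ φ → 1 ℕ.≤ x →
           φ e₁ ≡ toℤ₆ 1 → φ e₂ ≡ toℤ₆ x → φ e₃ ≡ neg₆ (toℤ₆ (1 ℕ.+ x)) →
           Admissible (λ e → + toℕ (φ e) + [ e₃ == e ]· -[1+ 5 ])
    lift φ flow nowhere-zero 1≤x φe₁ φe₂ φe₃ = record
      { small        = small₀
      ; excess-mod-6 = λ w → subst (+ 6 ∣_) (sym (excess-+ representative lowering w))
                                   (∣m∣n⇒∣m+n (representative-mod-6 w) (excess-∣ lowering 6∣lowering w))
      ; at-e₁        = cong₂ (λ a b → + toℕ a + [ b ]· -[1+ 5 ]) φe₁ (==-≢ (e₁≢e₃ ∘ sym))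
      ; at-e₂        = trans (cong₂ (λ a b → + toℕ a + [ b ]· -[1+ 5 ]) φe₂ (==-≢ (e₂≢e₃ ∘ sym)))
                             (trans (ℤP.+-identityʳ _) (cong +_ (toℕ-toℤ₆ x (s≤s (ℕP.m≤n⇒m≤1+n x≤4)))))
      ; at-e₃        = at-e₃₀ }
      where
      representative lowering : Fin m → ℤ
      representative e = + toℕ (φ e)
      lowering e = [ e₃ == e ]· -[1+ 5 ]

      6∣lowering : ∀ e → + 6 ∣ lowering e
      6∣lowering e with e₃ == e
      ... | true  = divides -[1+ 0 ] refl
      ... | false = divides 0ℤ refl

      representative-mod-6 : ∀ w → + 6 ∣ excess representative w
      representative-mod-6 w =
        subst (+ 6 ∣_) (sym (cong₂ _-_ (sumℤ-representatives φ (inEdges D w)) (sumℤ-representatives φ (outEdges D w))))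
              (equal-residues⇒6∣ (sumᴸ (map toℕ (map φ (inEdges D w)))) (sumᴸ (map toℕ (map φ (outEdges D w))))
                                 (flow w))

      lowered : + toℕ (φ e₃) + -[1+ 5 ] ≡ - (+ (1 ℕ.+ x))
      lowered = trans (cong (λ a → + toℕ a + -[1+ 5 ]) φe₃) (lowered-representative x x≤4)

      at-e₃₀ : + toℕ (φ e₃) + [ e₃ == e₃ ]· -[1+ 5 ] ≡ - (+ (1 ℕ.+ x))
      at-e₃₀ = trans (cong (λ b → + toℕ (φ e₃) + [ b ]· -[1+ 5 ]) (==-refl e₃)) lowered

      small₀ : Is6FlowValues (λ e → + toℕ (φ e) + [ e₃ == e ]· -[1+ 5 ])
      small₀ e with e₃ ≟ e
      ... | yes refl = subst SmallNonzero (sym lowered) (s≤s z≤n , s≤s (s≤s x≤4))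
      ... | no _     = subst SmallNonzero (sym (ℤP.+-identityʳ (+ toℕ (φ e)))) (ℕP.n≢0⇒n>0 (nowhere-zero e) , toℕ<n (φ e))

    rounding : (φ : Fin m → ℤ₆) → IsZ6Flow D φ → NowhereZero₆ φ → 1 ℕ.≤ x →
               φ e₁ ≡ toℤ₆ 1 → φ e₂ ≡ toℤ₆ x → φ e₃ ≡ neg₆ (toℤ₆ (1 ℕ.+ x)) →
               Σ (Fin m → ℤ) λ ψ → Admissible ψ × (∀ w → excess ψ w ≡ 0ℤ)
    rounding φ flow nowhere-zero 1≤x φe₁ φe₂ φe₃ =
      descend (suc (imbalance ψ₀)) ψ₀ (lift φ flow nowhere-zero 1≤x φe₁ φe₂ φe₃) ℕP.≤-refl
      where
      ψ₀ : Fin m → ℤ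
      ψ₀ e = + toℕ (φ e) + [ e₃ == e ]· -[1+ 5 ]

open FlowRounding
open import Data.Nat using (ℕ; _≤_; _+_)
open import Data.Product using (_,_)

mainTheorem13 : ∀ {n m} (D : Digraph n m) (v : Fin n) (e₁ e₂ e₃ : Fin m) →
    Degree3With D v e₁ e₂ e₃ →
    ((tail D e₁ ≡ v × tail D e₂ ≡ v × tail D e₃ ≡ v) ⊎
     (head D e₁ ≡ v × head D e₂ ≡ v × head D e₃ ≡ v)) →
    (x : ℕ) → 1 ≤ x → x ≤ 4 →
    (φ : Fin m → ℤ₆) → IsZ6Flow D φ → NowhereZero₆ φ →
    φ e₁ ≡ toℤ₆ 1 → φ e₂ ≡ toℤ₆ x → φ e₃ ≡ neg₆ (toℤ₆ (1 + x)) →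
    Σ (Fin m → ℤ) λ φ′ → IsZFlow D φ′ × Is6FlowValues φ′ ×
      φ′ e₁ ≡ + 1 × φ′ e₂ ≡ + x × φ′ e₃ ≡ - (+ (1 + x))
mainTheorem13 D v e₁ e₂ e₃ (e₁≢e₂ , e₁≢e₃ , e₂≢e₃ , _) oriented x 1≤x x≤4 φ flow nowhere-zero φe₁ φe₂ φe₃
  with Rounding.rounding D v e₁ e₂ e₃ e₁≢e₂ e₁≢e₃ e₂≢e₃ oriented x x≤4 φ flow nowhere-zero 1≤x φe₁ φe₂ φe₃
... | ψ , admissible , balanced =
  ψ , balanced⇒flow D ψ balanced , small admissible ,
  at-e₁ admissible , at-e₂ admissible , at-e₃ admissible
  where open Rounding.Admissible
        open Network using (balanced⇒flow)
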